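{- If $G$ is uniquely $p$-colorable and $r$ is an integer with $0<r\le p-1$ (and $r\le\Delta(G)$), then $\chi_r(G)=p$.
   Context: A graph $G$ is uniquely $p$-colorable if $\chi(G)=p$ and every proper $p$-coloring of $G$ induces the same partition of $V(G)$ into color classes. All graphs are simple, connected and undirected; $N_G(v)$ is the open neighborhood, $d(v)=|N_G(v)|$, $\Delta$ the maximum degree. For a coloring $c$ and vertex set $S$, $c(S)=\{c(u):u\in S\}$. For integers $k>0$ and $0<r\le\Delta(G)$ with $r\le k$, a conditional $(k,r)$-coloring of $G$ is a surjective map $c:V(G)\to\{1,\dots,k\}$ such that (C1) $c(u)\ne c(v)$ whenever $uv\in E(G)$, and (C2) $|c(N_G(v))|\ge\min\{d(v),r\}$ for every vertex $v$. $\chi_r(G)$ is the smallest $k$ for which $G$ has a conditional $(k,r)$-coloring. -}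

module Defs where

open import Data.Nat using (ℕ; zero; suc; _+_; _≤_; _<_; _⊔_)
open import Data.Fin using (Fin; zero; suc; _≟_)
open import Data.Bool using (Bool; true; false; if_then_else_; _∧_)
open import Data.Product using (Σ; ∃; _×_; _,_)
open import Relation.Binary.PropositionalEquality using (_≡_; _≢_)
open import Relation.Nullary.Decidable using (⌊_⌋)
open import Relation.Nullary using (¬_)
open import Function.Bundles using (_⇔_)

count : (n : ℕ) → (Fin n → Bool) → ℕ
count zero    P = 0
count (suc n) P = (if P zero then 1 else 0) + count n (λ i → P (suc i))

maxF : (n : ℕ) → (Fin n → ℕ) → ℕ
maxF zero    f = 0
maxF (suc n) f = f zero ⊔ maxF n (λ i → f (suc i))

anyF : (n : ℕ) → (Fin n → Bool) → Bool
anyF zero    P = false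
anyF (suc n) P = Data.Bool._∨_ (P zero) (anyF n (λ i → P (suc i)))

record Graph : Set where
  field
    n     : ℕ
    adj   : Fin n → Fin n → Bool
    sym   : ∀ u v → adj u v ≡ adj v u
    irrefl : ∀ v → adj v v ≡ false

open Graph public

data Reach (G : Graph) : Fin (n G) → Fin (n G) → Set where
  here : ∀ {v} → Reach G v v
  step : ∀ {u w v} → adj G u w ≡ true → Reach G w v → Reach G u v

Connected : Graph → Set
Connected G = ∀ u v → Reach G u v

deg : (G : Graph) → Fin (n G) → ℕ
deg G v = count (n G) (adj G v)

Δ : Graph → ℕ
Δ G = maxF (n G) (deg G)

nbrColours : (G : Graph) {k : ℕ} → (Fin (n G) → Fin k) → Fin (n G) → ℕ
nbrColours G {k} c v =
  count k (λ j → anyF (n G) (λ u → adj G v u ∧ ⌊ c u ≟ j ⌋))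

Proper : (G : Graph) {k : ℕ} → (Fin (n G) → Fin k) → Set
Proper G c = ∀ u v → adj G u v ≡ true → c u ≢ c v

Surjective : {A : Set} {k : ℕ} → (A → Fin k) → Set
Surjective {A} c = ∀ j → Σ A (λ v → c v ≡ j)

ChromaticNumber : Graph → ℕ → Set
ChromaticNumber G p =
  Σ (Fin (n G) → Fin p) (Proper G) ×
  (∀ k → k < p → ¬ Σ (Fin (n G) → Fin k) (Proper G))

-- uniquely p-colourable: χ(G) = p and all proper p-colourings induce the same partition
UniquelyColourable : Graph → ℕ → Set
UniquelyColourable G p =
  ChromaticNumber G p ×
  (∀ (c₁ c₂ : Fin (n G) → Fin p) → Proper G c₁ → Proper G c₂ →
     ∀ u v → (c₁ u ≡ c₁ v) ⇔ (c₂ u ≡ c₂ v))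

min : ℕ → ℕ → ℕ
min = Data.Nat._⊓_

-- conditional (k,r)-colouring (the side condition r ≤ k is part of the notion)
IsConditionalColouring : (G : Graph) (k r : ℕ) → (Fin (n G) → Fin k) → Set
IsConditionalColouring G k r c =
  r ≤ k × Surjective c × Proper G c ×
  (∀ v → min (deg G v) r ≤ nbrColours G c v)

ConditionalChromaticNumber : Graph → ℕ → ℕ → Set
ConditionalChromaticNumber G r p =
  Σ (Fin (n G) → Fin p) (IsConditionalColouring G p r) ×
  (∀ k → k < p → ¬ Σ (Fin (n G) → Fin k) (IsConditionalColouring G k r))

-- If a colour j ≠ c(v) were missing from N(v), recolouring v with j would give a second
-- proper p-colouring; since a p-colouring of a p-chromatic graph uses every colour, v
-- would then share a class with some vertex of colour j, contradicting uniqueness.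
-- So in the unique colouring every vertex sees all p − 1 other colours, which makes it a
-- conditional (p, r)-colouring for every r ≤ p − 1; and no k < p colours can suffice,
-- since conditional colourings are in particular proper.
module Submission where

open import Defs hiding (sym)
open import Data.Nat using (ℕ; zero; suc; _≤_; _<_; _∸_; z≤n; s≤s)
open import Data.Nat.Properties using (≤-refl; ≤-trans; m≤n+m; m≤n+m∸n; m∸n≤m; m⊓n≤n; +-monoʳ-≤)
open import Data.Fin using (Fin; zero; suc; _≟_; punchOut)
open import Data.Fin.Properties using (any?; punchOut-injective; suc-injective)
open import Data.Bool using (Bool; true; _∧_; _∨_) renaming (_≟_ to _≟ᵇ_)
open import Data.Bool.Properties using (∨-zeroʳ)
open import Data.Product using (Σ; ∃; _×_; _,_)
open import Relation.Binary.PropositionalEquality using (_≡_; _≢_; refl; sym; trans; cong; cong₂; module ≡-Reasoning)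
open import Relation.Nullary using (¬_; yes; no; contradiction)
open import Relation.Nullary.Decidable using (⌊_⌋; isYes≗does; dec-true; _×-dec_)
open import Function.Bundles using (Equivalence)

all⇒n≤count : ∀ n (P : Fin n → Bool) → (∀ j → P j ≡ true) → n ≤ count n P
all⇒n≤count zero    P all = z≤n
all⇒n≤count (suc n) P all rewrite all zero =
  s≤s (all⇒n≤count n (λ j → P (suc j)) (λ j → all (suc j)))

allBut⇒n∸1≤count : ∀ n (P : Fin n → Bool) (i : Fin n) →
                   (∀ j → j ≢ i → P j ≡ true) → n ∸ 1 ≤ count n P
allBut⇒n∸1≤count (suc n) P zero    allBut =
  ≤-trans (all⇒n≤count n (λ j → P (suc j)) (λ j → allBut (suc j) λ ()))
          (m≤n+m _ _)
allBut⇒n∸1≤count (suc n) P (suc i) allBut rewrite allBut zero (λ ()) =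
  ≤-trans (m≤n+m∸n n 1)
          (+-monoʳ-≤ 1 (allBut⇒n∸1≤count n (λ j → P (suc j)) i
                          (λ j j≢i → allBut (suc j) (λ e → j≢i (suc-injective e)))))

anyF-intro : ∀ n (P : Fin n → Bool) i → P i ≡ true → anyF n P ≡ true
anyF-intro (suc n) P zero    Pi rewrite Pi = refl
anyF-intro (suc n) P (suc i) Pi =
  trans (cong (P zero ∨_) (anyF-intro n (λ j → P (suc j)) i Pi)) (∨-zeroʳ (P zero))

module _ (G : Graph) where

  open ≡-Reasoning

  SeenFrom : ∀ {p} → (Fin (n G) → Fin p) → Fin (n G) → Fin p → Set
  SeenFrom c v j = ∃ λ u → adj G v u ≡ true × c u ≡ j

  allOthersSeen⇒p∸1≤nbrColours : ∀ {p} (c : Fin (n G) → Fin p) v →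
                                 (∀ j → j ≢ c v → SeenFrom c v j) → p ∸ 1 ≤ nbrColours G c v
  allOthersSeen⇒p∸1≤nbrColours {p} c v seen = allBut⇒n∸1≤count p _ (c v) occurs
    where
    occurs : ∀ j → j ≢ c v → anyF (n G) (λ u → adj G v u ∧ ⌊ c u ≟ j ⌋) ≡ true
    occurs j j≢cv with seen j j≢cv
    ... | u , vu , cu≡j =
      anyF-intro (n G) _ u (cong₂ _∧_ vu (trans (isYes≗does (c u ≟ j)) (dec-true (c u ≟ j) cu≡j)))

  noFewer⇒surjective : ∀ {p} → (∀ k → k < p → ¬ Σ (Fin (n G) → Fin k) (Proper G)) →
                       (c : Fin (n G) → Fin p) → Proper G c → Surjective c
  noFewer⇒surjective {zero}  fewer c proper ()
  noFewer⇒surjective {suc m} fewer c proper j with any? (λ v → c v ≟ j)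
  ... | yes hit = hit
  ... | no miss = contradiction (c′ , proper′) (fewer m ≤-refl)
    where
    j≢c : ∀ v → j ≢ c v
    j≢c v e = miss (v , sym e)
    c′ : Fin (n G) → Fin m
    c′ v = punchOut (j≢c v)
    proper′ : Proper G c′
    proper′ u v uv e = proper u v uv (punchOut-injective (j≢c u) (j≢c v) e)

  recolour : ∀ {p} → (Fin (n G) → Fin p) → Fin (n G) → Fin p → Fin (n G) → Fin p
  recolour c v j x with x ≟ v
  ... | yes _ = j
  ... | no  _ = c x

  recolour-self : ∀ {p} (c : Fin (n G) → Fin p) v j → recolour c v j v ≡ j
  recolour-self c v j with v ≟ v
  ... | yes _   = refl
  ... | no  v≢v = contradiction refl v≢v

  recolour-other : ∀ {p} (c : Fin (n G) → Fin p) v j x → x ≢ v → recolour c v j x ≡ c x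
  recolour-other c v j x x≢v with x ≟ v
  ... | yes x≡v = contradiction x≡v x≢v
  ... | no  _   = refl

  recolour-proper : ∀ {p} (c : Fin (n G) → Fin p) v j → Proper G c →
                    ¬ SeenFrom c v j → Proper G (recolour c v j)
  recolour-proper c v j proper unseen x y xy with x ≟ v | y ≟ v
  ... | yes refl | yes refl = λ _ → contradiction (trans (sym xy) (irrefl G x)) λ ()
  ... | yes refl | no  _    = λ j≡cy → unseen (y , xy , sym j≡cy)
  ... | no  _    | yes refl = λ cx≡j → unseen (x , trans (Graph.sym G y x) xy , cx≡j)
  ... | no  _    | no  _    = proper x y xy

  uniquelyColourable⇒allOthersSeen : ∀ {p} → UniquelyColourable G p →
                                     (c : Fin (n G) → Fin p) → Proper G c →
                                     ∀ v j → j ≢ c v → SeenFrom c v j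
  uniquelyColourable⇒allOthersSeen ((_ , fewer) , unique) c proper v j j≢cv
    with any? (λ u → (adj G v u ≟ᵇ true) ×-dec (c u ≟ j))
  ... | yes seen = seen
  ... | no unseen with noFewer⇒surjective fewer c proper j
  ...   | w , cw≡j = contradiction (trans (sym cw≡j) (sym cv≡cw)) j≢cv
    where
    w≢v : w ≢ v
    w≢v w≡v = j≢cv (trans (sym cw≡j) (cong c w≡v))
    recoloured-v≡w : recolour c v j v ≡ recolour c v j w
    recoloured-v≡w = begin
      recolour c v j v  ≡⟨ recolour-self c v j ⟩
      j                 ≡⟨ sym cw≡j ⟩
      c w               ≡⟨ sym (recolour-other c v j w w≢v) ⟩
      recolour c v j w  ∎
    cv≡cw : c v ≡ c w
    cv≡cw = Equivalence.to (unique _ c (recolour-proper c v j proper unseen) proper v w)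
                           recoloured-v≡w

proposition4p1 : (G : Graph) → Connected G → (p r : ℕ) →
    UniquelyColourable G p → 0 < r → r ≤ p ∸ 1 → r ≤ Δ G →
    ConditionalChromaticNumber G r p
proposition4p1 G _ p r uc@(((c , proper) , fewer) , _) _ r≤p∸1 _ =
  (c , ≤-trans r≤p∸1 (m∸n≤m p 1) , noFewer⇒surjective G fewer c proper , proper , enoughNbrColours) ,
  λ { k k<p (c′ , _ , _ , proper′ , _) → fewer k k<p (c′ , proper′) }
  where
  enoughNbrColours : ∀ v → min (deg G v) r ≤ nbrColours G c v
  enoughNbrColours v = ≤-trans (m⊓n≤n (deg G v) r)
               (≤-trans r≤p∸1
                 (allOthersSeen⇒p∸1≤nbrColours G c v
                   (uniquelyColourable⇒allOthersSeen G uc c proper v)))
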